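{- The relation $\simeq_{\mathbb{A}}$ is a congruence on the applicative structure $(\mathbb{A},\cdot)$: it is an equivalence relation on $\mathbb{A}$, and $a\simeq_{\mathbb{A}}a'$ and $b\simeq_{\mathbb{A}}b'$ imply $a\cdot b\simeq_{\mathbb{A}}a'\cdot b'$.
   Context: Addressing machines. Fix a countable set $\mathbb{A}$ of addresses and a symbol $\varnothing\notin\mathbb{A}$; $\mathbb{A}_\varnothing=\mathbb{A}\cup\{\varnothing\}$. A tape is a finite list of elements of $\mathbb{A}$; $a::T$ has head $a$ and tail $T$, $T@T'$ is concatenation. A program is a finite list of instructions generated by $P::=\mathtt{Load}\ i;P\mid A$, $A::=\mathtt{App}(i,j,k);A\mid C$, $C::=\mathtt{Call}\ i\mid\varepsilon$ ($i,j,k\in\mathbb{N}$). For $r\in\mathbb{N}$, $I\subseteq\{0,\dots,r-1\}$, $I\models^r P$ is the least relation such that: $I\models^r\varepsilon$; $I\models^r\mathtt{Call}\ i$ if $i\in I$; $I\models^r\mathtt{App}(i,j,k);A$ if $i,j\in I$ and either ($k<r$ and $I\cup\{k\}\models^r A$) or ($k\ge r$ and $I\models^r A$); $I\models^r\mathtt{Load}\ i;P$ if either ($i<r$ and $I\cup\{i\}\models^r P$) or ($i\ge r$ and $I\models^r P$). An addressing machine is $M=\langle R_0,\dots,R_{r-1},P,T\rangle$ with registers in $\mathbb{A}_\varnothing$, $P$ valid w.r.t. the registers ($\{i<r\mid R_i\ne\varnothing\}\models^r P$), and a tape $T$; $\mathcal{M}$ is the set of all of them. $\vec R[R_i:=a]$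 replaces $R_i$ by $a$ if $i<r$, is $\vec R$ if $i\ge r$. Fix a bijection $\#:\mathcal{M}\to\mathbb{A}$ with inverse $\#^{ -1}$; $M@T'=\langle M.\vec R,M.P,M.T@T'\rangle$; $a\cdot b=\#(\#^{ -1}(a)@[b])$. Head reduction: $\langle\vec R,\mathtt{Load}\ i;P,a::T\rangle\to_h\langle\vec R[R_i:=a],P,T\rangle$, $\langle\vec R,\mathtt{App}(i,j,k);P,T\rangle\to_h\langle\vec R[R_k:=R_i\cdot R_j],P,T\rangle$, $\langle\vec R,\mathtt{Call}\ i,T\rangle\to_h\#^{ -1}(R_i)@T$; $\twoheadrightarrow_h$ reflexive-transitive closure. Induced relations: for a relation $\equiv_R$ on $\mathcal{M}$, $a\simeq_R b$ iff $\#^{ -1}(a)\equiv_R\#^{ -1}(b)$; on $\mathbb{A}_\varnothing$, both $\varnothing$ or both addresses related; componentwise on tuples/tapes of equal length; $M=_R N$ iff $M.\vec R\simeq_R N.\vec R$, $M.P=N.P$, $M.T\simeq_R N.T$. $\equiv_{\mathbb{A}}$ is the least equivalence relation on $\mathcal{M}$ such that $M\twoheadrightarrow_h Z$ and $Z=_{\mathbb{A}}N$ imply $M\equiv_{\mathbb{A}}N$, with $\simeq_{\mathbb{A}},=_{\mathbb{A}}$ induced by $\equiv_{\mathbb{A}}$. -}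

module Defs where

open import Data.Nat using (ℕ; _<_; _≤_; _<?_)
open import Data.Fin using (Fin; fromℕ<)
open import Data.Fin.Subset using (Subset; _∈_; _∪_; ⁅_⁆)
open import Data.Maybe using (Maybe; just; nothing; is-just)
open import Data.Maybe.Relation.Binary.Pointwise as MaybeP using ()
open import Data.List using (List; []; _∷_; _++_; [_])
open import Data.List.Relation.Binary.Pointwise as ListP using ()
open import Data.Vec using (Vec; lookup; _[_]≔_)
open import Data.Vec.Relation.Binary.Pointwise.Inductive as VecP using ()
open import Data.Product using (Σ)
open import Relation.Nullary using (yes; no)
open import Relation.Binary.PropositionalEquality using (_≡_)
open import Relation.Binary.Construct.Closure.ReflexiveTransitive using (Star)
open import Function.Bundles using (Bijection)

-- Programs, following the grammar
--   P ::= Load i; P | A      A ::= App(i,j,k); A | C      C ::= Call i | ε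

data CProg : Set where
  call : ℕ → CProg
  ε    : CProg

data AProg : Set where
  app : ℕ → ℕ → ℕ → AProg → AProg
  ret : CProg → AProg

data Prog : Set where
  load : ℕ → Prog → Prog
  body : AProg → Prog

-- Validity  I ⊨ʳ P,  with I ⊆ {0,…,r-1} represented as a Subset r.

_∈ᴵ_ : ∀ {r} → ℕ → Subset r → Set
_∈ᴵ_ {r} i I = Σ (i < r) λ p → fromℕ< p ∈ I

data ⊨C (r : ℕ) (I : Subset r) : CProg → Set where
  ⊨ε    : ⊨C r I ε
  ⊨call : ∀ {i} → i ∈ᴵ I → ⊨C r I (call i)

data ⊨A (r : ℕ) : Subset r → AProg → Set where
  ⊨ret    : ∀ {I C} → ⊨C r I C → ⊨A r I (ret C)
  ⊨app-in : ∀ {I i j k A} → i ∈ᴵ I → j ∈ᴵ I → (p : k < r) →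
            ⊨A r (I ∪ ⁅ fromℕ< p ⁆) A → ⊨A r I (app i j k A)
  ⊨app-out : ∀ {I i j k A} → i ∈ᴵ I → j ∈ᴵ I → r ≤ k →
            ⊨A r I A → ⊨A r I (app i j k A)

data ⊨P (r : ℕ) : Subset r → Prog → Set where
  ⊨body    : ∀ {I A} → ⊨A r I A → ⊨P r I (body A)
  ⊨load-in : ∀ {I i P} → (p : i < r) → ⊨P r (I ∪ ⁅ fromℕ< p ⁆) P → ⊨P r I (load i P)
  ⊨load-out : ∀ {I i P} → r ≤ i → ⊨P r I P → ⊨P r I (load i P)

-- Machines over a set of addresses 𝔸 (register value  nothing = ∅)

module Machines (𝔸 : Set) where

  nonEmpty : ∀ {r} → Vec (Maybe 𝔸) r → Subset r
  nonEmpty R = Data.Vec.map is-just R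

  record Machine : Set where
    constructor mk
    field
      r     : ℕ
      R     : Vec (Maybe 𝔸) r
      P     : Prog
      valid : ⊨P r (nonEmpty R) P
      T     : List 𝔸
  open Machine public

  -- R_i (∅ when i ≥ r)
  _‼_ : ∀ {r} → Vec (Maybe 𝔸) r → ℕ → Maybe 𝔸
  _‼_ {r} R i with i <? r
  ... | yes p = lookup R (fromℕ< p)
  ... | no _  = nothing

  upd : ∀ {r} → Vec (Maybe 𝔸) r → ℕ → Maybe 𝔸 → Vec (Maybe 𝔸) r
  upd {r} R i x with i <? r
  ... | yes p = R [ fromℕ< p ]≔ x
  ... | no _  = R

  _++ᴹ_ : Machine → List 𝔸 → Machine
  mk r R P v T ++ᴹ T' = mk r R P v (T ++ T')

  MaybeRel : (𝔸 → 𝔸 → Set) → Maybe 𝔸 → Maybe 𝔸 → Set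
  MaybeRel _≈_ = MaybeP.Pointwise _≈_

  record MachineRel (_≈_ : 𝔸 → 𝔸 → Set) (M N : Machine) : Set where
    constructor mkRel
    field
      regs : VecP.Pointwise (MaybeRel _≈_) (R M) (R N)
      prog : P M ≡ P N
      tape : ListP.Pointwise _≈_ (T M) (T N)

  module WithCoding (bij : Bijection (Relation.Binary.PropositionalEquality.setoid Machine)
                                     (Relation.Binary.PropositionalEquality.setoid 𝔸)) where
    open Bijection bij using () renaming (to to #)
    open import Function.Bundles using (Inverse)
    open import Function.Properties.Bijection using (Bijection⇒Inverse)

    #⁻¹ : 𝔸 → Machine
    #⁻¹ = Inverse.from (Bijection⇒Inverse bij)

    _·_ : 𝔸 → 𝔸 → 𝔸
    a · b = # (#⁻¹ a ++ᴹ [ b ])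

    -- head reduction (the target machine is any valid machine with the
    -- prescribed components)
    data _→h_ : Machine → Machine → Set where
      load-step : ∀ {r R i P a T v v'} →
        mk r R (load i P) v (a ∷ T) →h mk r (upd R i (just a)) P v' T
      app-step : ∀ {r R i j k A a b T v v'} → R ‼ i ≡ just a → R ‼ j ≡ just b →
        mk r R (body (app i j k A)) v T →h mk r (upd R k (just (a · b))) (body A) v' T
      call-step : ∀ {r R i a T v} → R ‼ i ≡ just a →
        mk r R (body (ret (call i))) v T →h (#⁻¹ a ++ᴹ T)

    _↠h_ : Machine → Machine → Set
    _↠h_ = Star _→h_

    data _≡𝔸_ : Machine → Machine → Set where
      red   : ∀ {M Z N} → M ↠h Z → MachineRel (λ a b → #⁻¹ a ≡𝔸 #⁻¹ b) Z N → M ≡𝔸 N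
      refl𝔸  : ∀ {M} → M ≡𝔸 M
      sym𝔸   : ∀ {M N} → M ≡𝔸 N → N ≡𝔸 M
      trans𝔸 : ∀ {M N O} → M ≡𝔸 N → N ≡𝔸 O → M ≡𝔸 O

    _≃𝔸_ : 𝔸 → 𝔸 → Set
    a ≃𝔸 b = #⁻¹ a ≡𝔸 #⁻¹ b

{-# OPTIONS --safe #-}
module Submission where

-- Appending to the tape commutes with head reduction, since every step only
-- consumes the tape from the front, and it preserves the componentwise
-- relation =_𝔸.  So appending a tape of related addresses is a congruence for
-- each generating clause of ≡_𝔸, hence for ≡_𝔸 itself; a · b is #⁻¹ a with b
-- appended, read back through #⁻¹ ∘ # = id.

open import Defs
open import Data.Nat using (ℕ)
open import Data.Product using (_×_; _,_)
open import Data.List using (_++_; [_])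
open import Data.List.Properties using (++-assoc)
import Data.List.Relation.Binary.Pointwise as ListP
import Data.Maybe.Relation.Binary.Pointwise as MaybeP
import Data.Vec.Relation.Binary.Pointwise.Inductive as VecP
open import Function.Bundles using (Bijection; Injection; Inverse)
open import Function.Properties.Bijection using (Bijection⇒Inverse)
open import Relation.Binary.Structures using (IsEquivalence)
open import Relation.Binary.PropositionalEquality
  using (setoid; _≡_; refl; sym; cong; subst; subst₂)
open import Relation.Binary.Construct.Closure.ReflexiveTransitive using (ε; gmap)

module _ (𝔸 : Set) (bij : Bijection (setoid (Machines.Machine 𝔸)) (setoid 𝔸)) where
  open Machines 𝔸
  open WithCoding bij

  ≃𝔸-isEquivalence : IsEquivalence _≃𝔸_
  ≃𝔸-isEquivalence = record { refl = refl𝔸 ; sym = sym𝔸 ; trans = trans𝔸 }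

  ≃𝔸*-refl : ∀ {T} → ListP.Pointwise _≃𝔸_ T T
  ≃𝔸*-refl = ListP.refl refl𝔸

  #⁻¹∘#≡id : ∀ M → #⁻¹ (Bijection.to bij M) ≡ M
  #⁻¹∘#≡id = Inverse.strictlyInverseʳ (Bijection⇒Inverse bij)

  ++ᴹ-assoc : ∀ M T T′ → (M ++ᴹ T) ++ᴹ T′ ≡ M ++ᴹ (T ++ T′)
  ++ᴹ-assoc (mk r R P v T₀) T T′ = cong (mk r R P v) (++-assoc T₀ T T′)

  →h-++ᴹ : ∀ {M N} T → M →h N → (M ++ᴹ T) →h (N ++ᴹ T)
  →h-++ᴹ T load-step        = load-step
  →h-++ᴹ T (app-step p q)   = app-step p q
  →h-++ᴹ T (call-step {a = a} {T = T₀} p) =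
    subst (_ →h_) (sym (++ᴹ-assoc (#⁻¹ a) T₀ T)) (call-step p)

  ↠h-++ᴹ : ∀ {M N} T → M ↠h N → (M ++ᴹ T) ↠h (N ++ᴹ T)
  ↠h-++ᴹ T = gmap (_++ᴹ T) (→h-++ᴹ T)

  =𝔸-refl : ∀ {M} → MachineRel _≃𝔸_ M M
  =𝔸-refl = mkRel (VecP.refl (MaybeP.refl refl𝔸)) refl ≃𝔸*-refl

  =𝔸-++ᴹ : ∀ {M N T T′} → MachineRel _≃𝔸_ M N → ListP.Pointwise _≃𝔸_ T T′ →
           MachineRel _≃𝔸_ (M ++ᴹ T) (N ++ᴹ T′)
  =𝔸-++ᴹ {mk _ _ _ _ _} {mk _ _ _ _ _} (mkRel R≃ P≡ T≃) U≃ =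
    mkRel R≃ P≡ (ListP.++⁺ T≃ U≃)

  ≡𝔸-++ᴹ : ∀ {M N T T′} → M ≡𝔸 N → ListP.Pointwise _≃𝔸_ T T′ →
           (M ++ᴹ T) ≡𝔸 (N ++ᴹ T′)
  ≡𝔸-++ᴹ {T = T} (red M↠Z Z=N) U≃ = red (↠h-++ᴹ T M↠Z) (=𝔸-++ᴹ Z=N U≃)
  ≡𝔸-++ᴹ refl𝔸          U≃ = red ε (=𝔸-++ᴹ =𝔸-refl U≃)
  ≡𝔸-++ᴹ (sym𝔸 N≡M)     U≃ = sym𝔸 (≡𝔸-++ᴹ N≡M (ListP.symmetric sym𝔸 U≃))
  ≡𝔸-++ᴹ (trans𝔸 M≡N N≡O) U≃ = trans𝔸 (≡𝔸-++ᴹ M≡N U≃) (≡𝔸-++ᴹ N≡O ≃𝔸*-refl)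

  ·-cong : ∀ {a a′ b b′} → a ≃𝔸 a′ → b ≃𝔸 b′ → (a · b) ≃𝔸 (a′ · b′)
  ·-cong {a} {a′} {b} {b′} a≃a′ b≃b′ =
    subst₂ _≡𝔸_ (sym (#⁻¹∘#≡id (#⁻¹ a ++ᴹ [ b ]))) (sym (#⁻¹∘#≡id (#⁻¹ a′ ++ᴹ [ b′ ])))
      (≡𝔸-++ᴹ a≃a′ (b≃b′ ListP.∷ ListP.[]))

lemma3p6 : (𝔸 : Set) → Injection (setoid 𝔸) (setoid ℕ) →
    (bij : Bijection (setoid (Machines.Machine 𝔸)) (setoid 𝔸)) →
    let open Machines.WithCoding 𝔸 bij in
    IsEquivalence _≃𝔸_ ×
    (∀ {a a′ b b′} → a ≃𝔸 a′ → b ≃𝔸 b′ → (a · b) ≃𝔸 (a′ · b′))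
lemma3p6 𝔸 _ bij = ≃𝔸-isEquivalence 𝔸 bij , ·-cong 𝔸 bij
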